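{- Let $q$ be sufficiently large and let $F\colon\mathbb{B}\to\Sigma$ be a Sudoku solution with good columns. Let $A,B,C,D\in\mathbb{Z}/q\mathbb{Z}$ be such that $\Psi(n,m)=An+Bm+C+D\frac q4m(m-n)$ is nonzero at every cell of some square $\{n_0,\dots,n_0+7\}\times\{m_0,\dots,m_0+7\}$ with $1\le n_0\le N-7$, $m_0\in\mathbb{Z}$, and $F(n,m)=\Psi(n,m)$ for all $(n,m)\in\mathbb{B}$ with $\Psi(n,m)\neq0$. Then $B$ is odd.
   Context: $q=2^{s_0}$, $N=q^2$, $\Sigma=(\mathbb{Z}/q\mathbb{Z})\setminus\{0\}$, $\mathbb{B}=\{1,\dots,N\}\times\mathbb{Z}$. $f_q\colon\mathbb{Z}\to\Sigma$: $f_q(q^km)=m\bmod q$ for $k\ge0$, $m$ not divisible by $q$; $f_q(0)=1$. $\mathcal{S}[N]$: functions $g\colon\{1,\dots,N\}\to\Sigma$ of the form $g(n)=cf_q(an+b)$, $a,b,c\in\mathbb{Z}$, $c$ odd. A Sudoku solution is $F\colon\mathbb{B}\to\Sigma$ with $n\mapsto F(n,jn+i)$ in $\mathcal{S}[N]$ for all $i,j\in\mathbb{Z}$. It has good columns if for each $n$ there is a permutation $\sigma_n$ of $\mathbb{Z}/q\mathbb{Z}$ with $F(n,m)=\sigma_n(m\bmod q)$ whenever $\sigma_n(m\bmod q)\neq0$. -}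

module Defs where

open import Data.Nat as ℕ using (ℕ; zero; suc; NonZero; _^_; _≤_; _<_)
open import Data.Nat.Properties using (m^n≢0)
open import Data.Integer as ℤ using (ℤ; +_; _◃_; ∣_∣; sign)
open import Data.Integer.DivMod using (_%ℕ_; n%ℕd<d)
open import Data.Fin using (Fin; toℕ; fromℕ<)
open import Data.Fin.Permutation using (Permutation′; _⟨$⟩ʳ_)
open import Data.Product using (Σ; ∃; ∃-syntax; _×_)
open import Relation.Binary.PropositionalEquality using (_≡_; _≢_)

q : ℕ → ℕ
q s = 2 ^ s

q-nonZero : ∀ s → NonZero (q s)
q-nonZero s = m^n≢0 2 s

N : ℕ → ℕ
N s = q s ℕ.* q s

-- Elements of ℤ/qℤ are represented by their canonical residues in [0, q).
-- Reduction of an integer modulo q (as a natural residue)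
modq : ℕ → ℤ → ℕ
modq s x = _%ℕ_ x (q s) {{q-nonZero s}}

toZq : (s : ℕ) → ℤ → Fin (q s)
toZq s x = fromℕ< (n%ℕd<d x (q s) {{q-nonZero s}})

-- For n > 0, qfree s n = the unique m with n = q^k m and q ∤ m
-- (computed with fuel n, which suffices when q ≥ 2).
qfree-aux : ℕ → ℕ → ℕ → ℕ
qfree-aux s zero    n = n
qfree-aux s (suc f) n with ℕ._%_ n (q s) {{q-nonZero s}}
... | zero  = qfree-aux s f (ℕ._/_ n (q s) {{q-nonZero s}})
... | suc _ = n

qfree : ℕ → ℕ → ℕ
qfree s n = qfree-aux s n n

fq : ℕ → ℤ → ℕ
fq s (+ zero) = modq s (+ 1)
fq s x        = modq s (sign x ◃ qfree s ∣ x ∣)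

Oddℤ : ℤ → Set
Oddℤ c = c %ℕ 2 ≡ 1

InS : (s : ℕ) → (ℕ → ℕ) → Set
InS s g = ∃[ a ] ∃[ b ] ∃[ c ] (Oddℤ c ×
  (∀ n → 1 ≤ n → n ≤ N s → g n ≡ modq s (c ℤ.* + fq s (a ℤ.* + n ℤ.+ b))))

-- F : 𝔹 → Σ (only the values on 1 ≤ n ≤ N are relevant)
IntoΣ : (s : ℕ) → (ℕ → ℤ → ℕ) → Set
IntoΣ s F = ∀ n m → 1 ≤ n → n ≤ N s → (0 < F n m × F n m < q s)

SudokuSolution : (s : ℕ) → (ℕ → ℤ → ℕ) → Set
SudokuSolution s F = IntoΣ s F × (∀ i j → InS s (λ n → F n (j ℤ.* + n ℤ.+ i)))

GoodColumns : (s : ℕ) → (ℕ → ℤ → ℕ) → Set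
GoodColumns s F = ∀ n → 1 ≤ n → n ≤ N s →
  Σ (Permutation′ (q s)) λ σ → ∀ m →
    toℕ (σ ⟨$⟩ʳ toZq s m) ≢ 0 → F n m ≡ toℕ (σ ⟨$⟩ʳ toZq s m)

Ψ : (s : ℕ) → (A B C D : Fin (q s)) → ℕ → ℤ → ℕ
Ψ s A B C D n m = modq s
  (+ toℕ A ℤ.* + n ℤ.+ + toℕ B ℤ.* m ℤ.+ + toℕ C
    ℤ.+ + toℕ D ℤ.* + (q s ℕ./ 4) ℤ.* m ℤ.* (m ℤ.- + n))

-- If B is even then, because 8 divides q, the map m ↦ Ψ(n, m) has period h = q/2 in every
-- row n. Fix a column n₀ with its permutation σ. Where Ψ(n₀, m) ≠ 0 we get
-- F(n₀, m) = F(n₀, m + h), and since σ is injective and h ≢ 0 mod q, σ must vanish at m or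
-- at m + h. Applying this to m₀ and m₀ + 1 gives two zeros of σ at residues that differ by
-- 1, h - 1 or h + 1, all nonzero mod q; but σ, being a permutation, has only one zero.
module Submission where

open import Defs
open import Data.Nat using (ℕ; _≤_; _<_; _+_; _%_)
open import Data.Integer using (ℤ; +_) renaming (_+_ to _+ℤ_)
open import Data.Fin using (Fin; toℕ)
open import Data.Product using (∃-syntax; _×_)
open import Relation.Binary.PropositionalEquality using (_≡_; _≢_)

open import Data.Nat as ℕ using (suc; NonZero; z<s; s<s; s≤s; _^_)
import Data.Nat.Properties as ℕP
open import Data.Nat.DivMod using (m%n<n; m*n/n≡m)
import Data.Nat.Divisibility as ℕ∣
import Data.Nat.Tactic.RingSolver as ℕSolver
open import Data.Integer using (-_; _%ℕ_; _/ℕ_) renaming (_*_ to _*ℤ_; _-_ to _-ℤ_)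
import Data.Integer.Properties as ℤP
open import Data.Integer.DivMod using (a≡a%ℕn+[a/ℕn]*n; n%ℕd<d)
open import Data.Integer.Divisibility.Signed
  using (_∣_; divides; ∣⇒∣ᵤ; ∣m⇒∣-m; ∣m∣n⇒∣m+n; ∣m∣n⇒∣m-n)
open import Data.Integer.Tactic.RingSolver using (solve-∀)
open import Data.Fin.Permutation using (Permutation′; _⟨$⟩ʳ_)
open import Data.Fin.Properties using (toℕ-fromℕ<; toℕ-injective)
open import Data.Product using (_,_)
open import Data.Sum using (_⊎_; inj₁; inj₂)
open import Data.Empty using (⊥)
open import Function.Bundles using (Injection)
open import Function.Properties.Inverse using (↔⇒↣)
open import Relation.Binary.Definitions using (tri<; tri≈; tri>)
open import Relation.Nullary using (¬_; yes; no; contradiction)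
open import Relation.Binary.PropositionalEquality using (refl; sym; trans; cong; subst; module ≡-Reasoning)

>⇒+∤+ : ∀ {m n} → 0 < m → m < n → ¬ (+ n ∣ + m)
>⇒+∤+ 0<m m<n n∣m = ℕ∣.>⇒∤ {{ℕ.>-nonZero 0<m}} m<n (∣⇒∣ᵤ n∣m)

∣[+m-+n]⇒m≡n : ∀ {d m n} → m < d → n < d → + d ∣ + m -ℤ + n → m ≡ n
∣[+m-+n]⇒m≡n {d} {m} {n} m<d n<d d∣m-n with ℕP.<-cmp m n
... | tri≈ _ m≡n _ = m≡n
... | tri< m<n _ _ = contradiction (subst (+ d ∣_) -m+n≡n∸m (∣m⇒∣-m d∣m-n))
                                   (>⇒+∤+ (ℕP.m<n⇒0<n∸m m<n) (ℕP.≤-<-trans (ℕP.m∸n≤m n m) n<d))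
  where
  -m+n≡n∸m : - (+ m -ℤ + n) ≡ + (n ℕ.∸ m)
  -m+n≡n∸m = trans (cong -_ (trans (ℤP.[+m]-[+n]≡m⊖n m n) (ℤP.⊖-swap m n)))
                   (trans (ℤP.neg-involutive _) (ℤP.⊖-≥ (ℕP.<⇒≤ m<n)))
... | tri> _ _ n<m = contradiction (subst (+ d ∣_) m-n≡m∸n d∣m-n)
                                   (>⇒+∤+ (ℕP.m<n⇒0<n∸m n<m) (ℕP.≤-<-trans (ℕP.m∸n≤m m n) m<d))
  where
  m-n≡m∸n : + m -ℤ + n ≡ + (m ℕ.∸ n)
  m-n≡m∸n = trans (ℤP.[+m]-[+n]≡m⊖n m n) (ℤP.⊖-≥ (ℕP.<⇒≤ n<m))

module _ (d : ℕ) .{{_ : NonZero d}} where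

  ∣i-i%ℕd : ∀ i → + d ∣ i -ℤ + (i %ℕ d)
  ∣i-i%ℕd i = divides (i /ℕ d) (begin
    i -ℤ + (i %ℕ d)                              ≡⟨ cong (_-ℤ + (i %ℕ d)) (a≡a%ℕn+[a/ℕn]*n i d) ⟩
    + (i %ℕ d) +ℤ i /ℕ d *ℤ + d -ℤ + (i %ℕ d)    ≡⟨ cancel (+ (i %ℕ d)) (i /ℕ d *ℤ + d) ⟩
    i /ℕ d *ℤ + d                                ∎)
    where
    open ≡-Reasoning
    cancel : ∀ r x → r +ℤ x -ℤ r ≡ x
    cancel = solve-∀

  %ℕ≡⇒∣- : ∀ i j → i %ℕ d ≡ j %ℕ d → + d ∣ i -ℤ j
  %ℕ≡⇒∣- i j eq = subst (+ d ∣_) (cancel i j (+ (j %ℕ d)))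
    (subst (λ r → + d ∣ (i -ℤ + r) -ℤ (j -ℤ + (j %ℕ d))) eq (∣m∣n⇒∣m-n (∣i-i%ℕd i) (∣i-i%ℕd j)))
    where
    cancel : ∀ i j r → (i -ℤ r) -ℤ (j -ℤ r) ≡ i -ℤ j
    cancel = solve-∀

  ∣-⇒%ℕ≡ : ∀ i j → + d ∣ i -ℤ j → i %ℕ d ≡ j %ℕ d
  ∣-⇒%ℕ≡ i j d∣i-j = ∣[+m-+n]⇒m≡n (n%ℕd<d i d) (n%ℕd<d j d)
    (subst (+ d ∣_) (rearrange i j (+ (i %ℕ d)) (+ (j %ℕ d)))
           (∣m∣n⇒∣m+n (∣m∣n⇒∣m-n d∣i-j (∣i-i%ℕd i)) (∣i-i%ℕd j)))
    where
    rearrange : ∀ i j r r′ → (i -ℤ j) -ℤ (i -ℤ r) +ℤ (j -ℤ r′) ≡ r -ℤ r′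
    rearrange = solve-∀

¬2∣⇒%2≡1 : ∀ n → ¬ (2 ℕ∣.∣ n) → n % 2 ≡ 1
¬2∣⇒%2≡1 n 2∤n with n % 2 in eq | m%n<n n 2
... | 0 | _ = contradiction (ℕ∣.m%n≡0⇒n∣m n 2 eq) 2∤n
... | 1 | _ = refl
... | suc (suc _) | s≤s (s≤s ())

-- Ψ s A B C D n m is definitionally modq s (ψ (+ toℕ A) (+ toℕ B) (+ toℕ C) (+ toℕ D) (+ (q s / 4)) (+ n) m).
ψ : (A B C D Q n m : ℤ) → ℤ
ψ A B C D Q n m = A *ℤ n +ℤ B *ℤ m +ℤ C +ℤ D *ℤ Q *ℤ m *ℤ (m -ℤ n)

ψ-periodic : ∀ A C D n {B Q h d} b k m →
  B ≡ b *ℤ + 2 → Q ≡ k *ℤ + 2 → h ≡ k *ℤ + 4 → d ≡ k *ℤ + 8 →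
  d ∣ ψ A B C D Q n (m +ℤ h) -ℤ ψ A B C D Q n m
ψ-periodic A C D n b k m refl refl refl refl =
  divides (b +ℤ D *ℤ k *ℤ (m *ℤ + 2 -ℤ n +ℤ k *ℤ + 4)) (shift A b C D k n m)
  where
  shift : ∀ A b C D k n m →
    (A *ℤ n +ℤ b *ℤ + 2 *ℤ (m +ℤ k *ℤ + 4) +ℤ C
       +ℤ D *ℤ (k *ℤ + 2) *ℤ (m +ℤ k *ℤ + 4) *ℤ (m +ℤ k *ℤ + 4 -ℤ n))
    -ℤ (A *ℤ n +ℤ b *ℤ + 2 *ℤ m +ℤ C +ℤ D *ℤ (k *ℤ + 2) *ℤ m *ℤ (m -ℤ n))
      ≡ (b +ℤ D *ℤ k *ℤ (m *ℤ + 2 -ℤ n +ℤ k *ℤ + 4)) *ℤ (k *ℤ + 8)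
  shift = solve-∀

Ψ-periodic : ∀ t (A B C D : Fin (q (3 + t))) n m → 2 ℕ∣.∣ toℕ B →
  Ψ (3 + t) A B C D n (m +ℤ + q (2 + t)) ≡ Ψ (3 + t) A B C D n m
Ψ-periodic t A B C D n m (ℕ∣.divides b B≡b*2) =
  ∣-⇒%ℕ≡ (q (3 + t)) {{q-nonZero (3 + t)}} (ψ′ (m +ℤ + q (2 + t))) (ψ′ m)
    (ψ-periodic (+ toℕ A) (+ toℕ C) (+ toℕ D) (+ n) (+ b) (+ k) m
      (cast b 2 B≡b*2) (cast k 2 q/4≡k*2) (cast k 4 q/2≡k*4) (cast k 8 q≡k*8))
  where
  k : ℕ
  k = 2 ^ t
  ψ′ : ℤ → ℤ
  ψ′ = ψ (+ toℕ A) (+ toℕ B) (+ toℕ C) (+ toℕ D) (+ (q (3 + t) ℕ./ 4)) (+ n)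
  cast : ∀ {x} y z → x ≡ y ℕ.* z → + x ≡ + y *ℤ + z
  cast y z eq = trans (cong +_ eq) (ℤP.pos-* y z)
  4*k : ∀ k → 2 ℕ.* (2 ℕ.* k) ≡ k ℕ.* 4
  4*k = ℕSolver.solve-∀
  8*k : ∀ k → 2 ℕ.* (2 ℕ.* (2 ℕ.* k)) ≡ k ℕ.* 2 ℕ.* 4
  8*k = ℕSolver.solve-∀
  q/2≡k*4 : q (2 + t) ≡ k ℕ.* 4
  q/2≡k*4 = 4*k k
  q≡k*8 : q (3 + t) ≡ k ℕ.* 8
  q≡k*8 = trans (8*k k) (ℕP.*-assoc k 2 4)
  q/4≡k*2 : q (3 + t) ℕ./ 4 ≡ k ℕ.* 2
  q/4≡k*2 = trans (cong (ℕ._/ 4) (8*k k)) (m*n/n≡m (k ℕ.* 2) 4)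

module Column (s : ℕ) (σ : Permutation′ (q s)) where

  private instance
    q-nonZero′ : NonZero (q s)
    q-nonZero′ = q-nonZero s

  Blank : ℤ → Set
  Blank m = toℕ (σ ⟨$⟩ʳ toZq s m) ≡ 0

  σ-values-equal⇒∣- : ∀ i j → toℕ (σ ⟨$⟩ʳ toZq s i) ≡ toℕ (σ ⟨$⟩ʳ toZq s j) → + q s ∣ i -ℤ j
  σ-values-equal⇒∣- i j eq = %ℕ≡⇒∣- (q s) i j (begin
    modq s i            ≡⟨ toℕ-fromℕ< _ ⟨
    toℕ (toZq s i)      ≡⟨ cong toℕ (Injection.injective (↔⇒↣ σ) (toℕ-injective eq)) ⟩
    toℕ (toZq s j)      ≡⟨ toℕ-fromℕ< _ ⟩
    modq s j            ∎)
    where open ≡-Reasoning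

  blanks-apart : ∀ i j e → j -ℤ i ≡ + e → 0 < e → e < q s → Blank i → Blank j → ⊥
  blanks-apart i j e j-i≡e 0<e e<q blank-i blank-j =
    >⇒+∤+ 0<e e<q (subst (+ q s ∣_) j-i≡e (σ-values-equal⇒∣- j i (trans blank-j (sym blank-i))))

  blank-at-repeat : ∀ (G : ℤ → ℕ) → (∀ m → ¬ Blank m → G m ≡ toℕ (σ ⟨$⟩ʳ toZq s m)) →
    ∀ m h → 0 < h → h < q s → G m ≡ G (m +ℤ + h) → Blank m ⊎ Blank (m +ℤ + h)
  blank-at-repeat G agree m h 0<h h<q Gm≡Gm+h with toℕ (σ ⟨$⟩ʳ toZq s m) ℕ.≟ 0
                                              | toℕ (σ ⟨$⟩ʳ toZq s (m +ℤ + h)) ℕ.≟ 0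
  ... | yes blank | _         = inj₁ blank
  ... | no _      | yes blank = inj₂ blank
  ... | no ¬blank | no ¬blank′ = contradiction
    (σ-values-equal⇒∣- (m +ℤ + h) m (trans (sym (agree (m +ℤ + h) ¬blank′))
                                        (trans (sym Gm≡Gm+h) (agree m ¬blank))))
    (λ q∣ → >⇒+∤+ 0<h h<q (subst (+ q s ∣_) (m+h-m≡h m (+ h)) q∣))
    where
    m+h-m≡h : ∀ m h → m +ℤ h -ℤ m ≡ h
    m+h-m≡h = solve-∀

  adjacent-blank-pairs : ∀ m h → 2 ≤ h → suc h < q s →
    Blank m ⊎ Blank (m +ℤ + h) → Blank (m +ℤ + 1) ⊎ Blank (m +ℤ + 1 +ℤ + h) → ⊥
  adjacent-blank-pairs m (suc (suc h′)) (s≤s (s≤s _)) 3+h′<q = apart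
    where
    1+h′<q : 1 + h′ < q s
    1+h′<q = ℕP.<-trans (ℕP.n<1+n _) (ℕP.<-trans (ℕP.n<1+n _) 3+h′<q)
    1<q : 1 < q s
    1<q = ℕP.≤-<-trans z<s 1+h′<q
    gap-1 : ∀ m → m +ℤ + 1 -ℤ m ≡ + 1
    gap-1 = solve-∀
    gap-h+1 : ∀ m x → m +ℤ + 1 +ℤ (+ 2 +ℤ x) -ℤ m ≡ + 3 +ℤ x
    gap-h+1 = solve-∀
    gap-h-1 : ∀ m x → m +ℤ (+ 2 +ℤ x) -ℤ (m +ℤ + 1) ≡ + 1 +ℤ x
    gap-h-1 = solve-∀
    gap-1′ : ∀ m x → m +ℤ + 1 +ℤ (+ 2 +ℤ x) -ℤ (m +ℤ (+ 2 +ℤ x)) ≡ + 1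
    gap-1′ = solve-∀
    apart : Blank m ⊎ Blank (m +ℤ + (2 + h′)) → Blank (m +ℤ + 1) ⊎ Blank (m +ℤ + 1 +ℤ + (2 + h′)) → ⊥
    apart (inj₁ b₀) (inj₁ b₁) = blanks-apart m (m +ℤ + 1) 1 (gap-1 m) z<s 1<q b₀ b₁
    apart (inj₁ b₀) (inj₂ b₁) = blanks-apart m (m +ℤ + 1 +ℤ + (2 + h′)) (3 + h′) (gap-h+1 m (+ h′)) z<s 3+h′<q b₀ b₁
    apart (inj₂ b₀) (inj₁ b₁) = blanks-apart (m +ℤ + 1) (m +ℤ + (2 + h′)) (1 + h′) (gap-h-1 m (+ h′)) z<s 1+h′<q b₁ b₀
    apart (inj₂ b₀) (inj₂ b₁) = blanks-apart (m +ℤ + (2 + h′)) (m +ℤ + 1 +ℤ + (2 + h′)) 1 (gap-1′ m (+ h′)) z<s 1<q b₀ b₁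

1<n⇒1+n<2*n : ∀ {n} → 1 < n → suc n < 2 ℕ.* n
1<n⇒1+n<2*n {n} 1<n =
  ℕP.<-≤-trans (ℕP.+-monoˡ-< n 1<n) (ℕP.≤-reflexive (cong (n ℕ.+_) (sym (ℕP.+-identityʳ n))))

square⇒adjacent-cells : ∀ s (A B C D : Fin (q s)) →
  (∃[ n₀ ] ∃[ m₀ ] (1 ≤ n₀ × n₀ + 7 ≤ N s ×
    (∀ i j → i < 8 → j < 8 → Ψ s A B C D (n₀ + i) (m₀ +ℤ + j) ≢ 0))) →
  ∃[ n₀ ] ∃[ m₀ ] (1 ≤ n₀ × n₀ ≤ N s ×
    Ψ s A B C D n₀ m₀ ≢ 0 × Ψ s A B C D n₀ (m₀ +ℤ + 1) ≢ 0)
square⇒adjacent-cells s A B C D (n₀ , m₀ , 1≤n₀ , n₀+7≤N , square≢0) =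
  n₀ , m₀ , 1≤n₀ , ℕP.≤-trans (ℕP.m≤m+n n₀ 7) n₀+7≤N ,
  subst (λ m → Ψ s A B C D n₀ m ≢ 0) (ℤP.+-identityʳ m₀) (first-row 0 z<s) ,
  first-row 1 (s<s z<s)
  where
  first-row : ∀ j → j < 8 → Ψ s A B C D n₀ (m₀ +ℤ + j) ≢ 0
  first-row j j<8 = subst (λ n → Ψ s A B C D n (m₀ +ℤ + j) ≢ 0) (ℕP.+-identityʳ n₀)
                          (square≢0 0 j z<s j<8)

even-B-impossible : ∀ t (F : ℕ → ℤ → ℕ) → GoodColumns (3 + t) F → (A B C D : Fin (q (3 + t))) →
  (∀ n m → 1 ≤ n → n ≤ N (3 + t) → Ψ (3 + t) A B C D n m ≢ 0 → F n m ≡ Ψ (3 + t) A B C D n m) →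
  ∀ n₀ m₀ → 1 ≤ n₀ → n₀ ≤ N (3 + t) →
  Ψ (3 + t) A B C D n₀ m₀ ≢ 0 → Ψ (3 + t) A B C D n₀ (m₀ +ℤ + 1) ≢ 0 → ¬ (2 ℕ∣.∣ toℕ B)
even-B-impossible t F good A B C D F≡Ψ n₀ m₀ 1≤n₀ n₀≤N Ψ₀≢0 Ψ₁≢0 2∣B with good n₀ 1≤n₀ n₀≤N
... | σ , σ-column =
  adjacent-blank-pairs m₀ h 2≤h h+1<q (blank-pair m₀ Ψ₀≢0) (blank-pair (m₀ +ℤ + 1) Ψ₁≢0)
  where
  open Column (3 + t) σ
  h : ℕ
  h = q (2 + t)
  P : ℤ → ℕ
  P = Ψ (3 + t) A B C D n₀
  2≤h : 2 ≤ h
  2≤h = ℕP.m≤m*n 2 (q (1 + t)) {{q-nonZero (1 + t)}}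
  h+1<q : suc h < q (3 + t)
  h+1<q = 1<n⇒1+n<2*n 2≤h
  period : ∀ m → P (m +ℤ + h) ≡ P m
  period m = Ψ-periodic t A B C D n₀ m 2∣B
  repeat : ∀ m → P m ≢ 0 → F n₀ m ≡ F n₀ (m +ℤ + h)
  repeat m Pm≢0 = begin
    F n₀ m             ≡⟨ F≡Ψ n₀ m 1≤n₀ n₀≤N Pm≢0 ⟩
    P m                ≡⟨ period m ⟨
    P (m +ℤ + h)       ≡⟨ F≡Ψ n₀ (m +ℤ + h) 1≤n₀ n₀≤N (λ P≡0 → Pm≢0 (trans (sym (period m)) P≡0)) ⟨
    F n₀ (m +ℤ + h)    ∎
    where open ≡-Reasoning
  blank-pair : ∀ m → P m ≢ 0 → Blank m ⊎ Blank (m +ℤ + h)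
  blank-pair m Pm≢0 = blank-at-repeat (F n₀) σ-column m h
    (ℕP.<-trans z<s 2≤h) (ℕP.<-trans (ℕP.n<1+n h) h+1<q) (repeat m Pm≢0)

proposition9p5 : ∃[ K ] (∀ (s : ℕ) → K ≤ s →
    (F : ℕ → ℤ → ℕ) → SudokuSolution s F → GoodColumns s F →
    (A B C D : Fin (q s)) →
    (∃[ n₀ ] ∃[ m₀ ] (1 ≤ n₀ × n₀ + 7 ≤ N s ×
      (∀ i j → i < 8 → j < 8 → Ψ s A B C D (n₀ + i) (m₀ +ℤ + j) ≢ 0))) →
    (∀ n m → 1 ≤ n → n ≤ N s → Ψ s A B C D n m ≢ 0 → F n m ≡ Ψ s A B C D n m) →
    toℕ B % 2 ≡ 1)
proposition9p5 = 3 , λ where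
  (suc (suc (suc t))) (s≤s (s≤s (s≤s _))) F _ good A B C D square F≡Ψ →
    let n₀ , m₀ , 1≤n₀ , n₀≤N , Ψ₀≢0 , Ψ₁≢0 = square⇒adjacent-cells (3 + t) A B C D square
    in ¬2∣⇒%2≡1 (toℕ B) (even-B-impossible t F good A B C D F≡Ψ n₀ m₀ 1≤n₀ n₀≤N Ψ₀≢0 Ψ₁≢0)
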